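{- (1) Let $\lambda\in A^{(n)}$ and let $\widehat{\alpha}=n(\epsilon_i-\epsilon_j)+sn^2\delta$ with $i<j$ and $s\in\mathbb{Z}$. Then the power of $q$ in $\gamma(\widehat{\alpha};\lambda)$ is zero if and only if either $s=0$ and $\lambda_i=\lambda_j$, or $s=-1$ and $\lambda_i-\lambda_j=n$. (2) For every $\widehat{\alpha}\in\widetilde{\Phi}^{(n)}$ and every $\lambda\in\mathbb{Z}^r$, $\gamma(\widehat{\alpha};\lambda)\neq 1$.
   Context: Fix integers $r\geq 2$, $n\geq 1$. Let $\epsilon_1,\dots,\epsilon_r$ be the standard basis of $\mathbb{R}^r$ with standard inner product $(\cdot,\cdot)$; $\Phi=\{\epsilon_i-\epsilon_j:i\ne j\}$, $\Phi_+=\{\epsilon_i-\epsilon_j:i<j\}$, $P=\mathbb{Z}^r$. Let $\delta$ be a formal symbol and $P_a^{(n)}=nP\oplus n^2\mathbb{Z}\delta$. The (real) affine roots are $\widetilde{\Phi}^{(n)}=\{n\alpha+sn^2\delta:\alpha\in\Phi,s\in\mathbb{Z}\}$. $A^{(n)}=\{\lambda\in\mathbb{Z}^r:\lambda_1\ge\lambda_2\ge\dots\ge\lambda_r,\ \lambda_1-\lambda_r\le n\}$. Parameters: $k$ and $G_j$ ($j\in\mathbb{Z}$) with $G_0=k$, $G_jG_{ -j}=1$, $G_j=G_{j'}$ whenever $j\equiv j'\pmod n$ (for $n$ even $G_{n/2}\in\{\pm1\}$ fixed); $k,q,G_1,\dots,G_{\lfloor(n-1)/2\rfloor}$ independent indeterminates,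 $\mathbb{F}^{(n)}=\mathbb{C}(k,G_1,\dots,G_{\lfloor(n-1)/2\rfloor})(q)$. $\sigma(a)=k^{ -1}$ if $a\in n\mathbb{Z}_{>0}$, $\sigma(a)=G_a$ otherwise. For $\widehat{\mu}=\mu+sn^2\delta\in P_a^{(n)}$ and $\lambda\in\mathbb{Z}^r$, \[\gamma(\widehat{\mu};\lambda)=q^{ -sn-(\mu,\lambda)/n}\prod_{\alpha\in\Phi_+}\sigma((\lambda,\alpha))^{(\mu,\alpha)/n};\] "the power of $q$" in it is the exponent $-sn-(\mu,\lambda)/n$ (the remaining factor does not involve $q$). -}

module Defs where

open import Data.Bool using (Bool; true; false; _xor_; _∧_; if_then_else_)
open import Data.Nat as ℕ using (ℕ; zero; suc; NonZero)
open import Data.Integer using (ℤ; +_; -_; _+_; _-_; _*_; _≤_; _%ℕ_; ∣_∣)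
open import Data.Fin using (Fin; fromℕ)
import Data.Fin as F
open import Data.Vec using (Vec; []; _∷_; replicate; zipWith; map)
open import Data.Product using (_×_)
open import Data.Unit using (⊤)
open import Relation.Nullary.Decidable using (⌊_⌋)

-- Signed Laurent monomials in the independent indeterminates
-- q, k, G_1, ..., G_m  (m = ⌊(n-1)/2⌋).  These form the subgroup of
-- the multiplicative group of F^(n) generated by -1, q, k, G_1..G_m,
-- which is free abelian (times {±1}) since the indeterminates are
-- independent.  An element is
--   (-1)^[neg] * q^qexp * k^kexp * ∏_t G_{t+1}^(gexp t).

record Mono (m : ℕ) : Set where
  constructor mono
  field
    neg  : Bool
    qexp : ℤ
    kexp : ℤ
    gexp : Vec ℤ m
open Mono public

one : ∀ {m} → Mono m
one = mono false (+ 0) (+ 0) (replicate _ (+ 0))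

_·_ : ∀ {m} → Mono m → Mono m → Mono m
mono s a b v · mono s' a' b' v' = mono (s xor s') (a + a') (b + b') (zipWith _+_ v v')

oddℤ : ℤ → Bool
oddℤ e = ∣ e ∣ ℕ.% 2 ℕ.≡ᵇ 1

_^ᶻ_ : ∀ {m} → Mono m → ℤ → Mono m
mono s a b v ^ᶻ e = mono (s ∧ oddℤ e) (a * e) (b * e) (map (_* e) v)

unitVec : (m : ℕ) → ℕ → ℤ → Vec ℤ m
unitVec zero    _       _ = []
unitVec (suc m) zero    z = z ∷ replicate m (+ 0)
unitVec (suc m) (suc p) z = + 0 ∷ unitVec m p z

qM : ∀ {m} → Mono m
qM = mono false (+ 1) (+ 0) (replicate _ (+ 0))

kM : ∀ {m} → Mono m
kM = mono false (+ 0) (+ 1) (replicate _ (+ 0))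

kInvM : ∀ {m} → Mono m
kInvM = mono false (+ 0) (- (+ 1)) (replicate _ (+ 0))

GM : ∀ {m} → ℕ → Mono m
GM {m} t = mono false (+ 0) (+ 0) (unitVec m (t ℕ.∸ 1) (+ 1))

GInvM : ∀ {m} → ℕ → Mono m
GInvM {m} t = mono false (+ 0) (+ 0) (unitVec m (t ℕ.∸ 1) (- (+ 1)))

-- the fixed sign G_{n/2} ∈ {±1} (n even); eps = true means -1
signM : ∀ {m} → Bool → Mono m
signM eps = mono eps (+ 0) (+ 0) (replicate _ (+ 0))

mOf : ℕ → ℕ
mOf n = (n ℕ.∸ 1) ℕ./ 2

-- G_j for j ∈ ℤ:  G_0 = k, G_j = G_{j mod n}, G_j G_{-j} = 1,
-- G_{n/2} = eps (n even), G_1..G_m independent.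

Gj : (n : ℕ) .{{_ : NonZero n}} → Bool → ℤ → Mono (mOf n)
Gj n eps j with j %ℕ n
... | t = if t ℕ.≡ᵇ 0 then kM
          else if t ℕ.≤ᵇ mOf n then GM t
          else if (2 ℕ.* t) ℕ.≡ᵇ n then signM eps
          else GInvM (n ℕ.∸ t)

σ : (n : ℕ) .{{_ : NonZero n}} → Bool → ℤ → Mono (mOf n)
σ n eps a = if (0 ℕ.<ᵇ ∣ a ∣) ∧ ⌊ + 0 Data.Integer.<? a ⌋ ∧ ((a %ℕ n) ℕ.≡ᵇ 0)
            then kInvM else Gj n eps a

Σℤ : ∀ {r} → (Fin r → ℤ) → ℤ
Σℤ {zero}  f = + 0
Σℤ {suc r} f = f F.zero + Σℤ (λ i → f (F.suc i))

⟨_,_⟩ : ∀ {r} → (Fin r → ℤ) → (Fin r → ℤ) → ℤ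
⟨ x , y ⟩ = Σℤ (λ i → x i * y i)

basis : ∀ {r} → Fin r → Fin r → ℤ
basis i j = if ⌊ i F.≟ j ⌋ then + 1 else + 0

root : ∀ {r} → Fin r → Fin r → (Fin r → ℤ)
root i j = λ l → basis i l - basis j l

∏Fin : ∀ {r m} → (Fin r → Mono m) → Mono m
∏Fin {zero}  f = one
∏Fin {suc r} f = f F.zero · ∏Fin (λ i → f (F.suc i))

∏Φ₊ : ∀ {r m} → (Fin r → Fin r → Mono m) → Mono m
∏Φ₊ f = ∏Fin (λ i → ∏Fin (λ j → if ⌊ i F.<? j ⌋ then f i j else one))

-- γ(μ̂; λ) for μ̂ = μ + s n² δ ∈ P_a^(n), written μ = n ν with ν ∈ ℤ^r.
-- Then (μ,λ)/n = (ν,λ) and (μ,α)/n = (ν,α):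
--   γ = q^{-sn-(ν,λ)} ∏_{α∈Φ₊} σ((λ,α))^{(ν,α)}

γ : (n : ℕ) .{{_ : NonZero n}} → Bool → ∀ {r} →
    (ν : Fin r → ℤ) → (s : ℤ) → (lam : Fin r → ℤ) → Mono (mOf n)
γ n eps ν s lam =
  (qM ^ᶻ (- (s * + n) - ⟨ ν , lam ⟩))
  · ∏Φ₊ (λ i j → σ n eps ⟨ lam , root i j ⟩ ^ᶻ ⟨ ν , root i j ⟩)

qPower : (n : ℕ) .{{_ : NonZero n}} → Bool → ∀ {r} →
         (ν : Fin r → ℤ) → (s : ℤ) → (lam : Fin r → ℤ) → ℤ
qPower n eps ν s lam = qexp (γ n eps ν s lam)

InA : (n r : ℕ) → (Fin r → ℤ) → Set
InA n zero    lam = ⊤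
InA n (suc r) lam =
  (∀ (i j : Fin (suc r)) → i F.≤ j → lam j ≤ lam i)
  × (lam F.zero - lam (fromℕ r) ≤ + n)

{-# OPTIONS --safe #-}
-- The q-exponent of γ(n(εᵢ − εⱼ) + sn²δ; λ) is −sn − (λᵢ − λⱼ). For λ ∈ A⁽ⁿ⁾ and i < j we have
-- 0 ≤ λᵢ − λⱼ ≤ n, so it vanishes exactly when s = 0, λᵢ = λⱼ or s = −1, λᵢ − λⱼ = n: this is (1).
-- For (2), γ = 1 forces n ∣ λᵢ − λⱼ and a vanishing k-exponent. Antisymmetrising the product over
-- Φ₊ writes that exponent as Σ_b (κ(i,b) − κ(j,b)), where κ(a,b) = 0 unless λₐ ≡ λ_b mod n, and
-- then κ(a,b) = sgn(μ_b − μₐ) for the key μₐ = rλₐ + a. As sgn is monotone, if μᵢ < μⱼ every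
-- summand is ≥ 0 and the one at b = i is 1 (symmetrically if μⱼ < μᵢ); μ being injective, the
-- k-exponent never vanishes.
module Submission where

open import Defs
open import Data.Bool using (Bool)
open import Data.Nat using (ℕ; NonZero; _≤_)
open import Data.Integer using (ℤ; +_; -_; _-_)
open import Data.Fin using (Fin; _<_)
open import Data.Product using (_×_)
open import Data.Sum using (_⊎_)
open import Function.Bundles using (_⇔_)
open import Relation.Binary.PropositionalEquality using (_≡_; _≢_)

open import Data.Bool.Base using (true; false; if_then_else_; _∧_)
open import Data.Bool.Properties using (∧-zeroʳ)
open import Data.Nat.Base as ℕ using (zero; suc)
import Data.Nat.Properties as ℕ
open import Data.Nat.Divisibility using (n∣m⇒m%n≡0)
open import Data.Integer.Base as ℤ
  using (-[1+_]; +[1+_]; _+_; _*_; ∣_∣; _%ℕ_; _/ℕ_; 0ℤ; 1ℤ; -1ℤ; +≤+; +<+; -≤+; -≤-; -<+)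
import Data.Integer.Properties as ℤ
open import Data.Integer.DivMod using (a≡a%ℕn+[a/ℕn]*n)
open import Data.Integer.Divisibility.Signed using (_∣_; divides; _∣?_; ∣⇒∣ᵤ; ∣m⇒∣-m; ∣m∣n⇒∣m+n)
open import Data.Integer.Tactic.RingSolver using (solve-∀)
open import Data.Fin.Base as Fin using (zero; suc; toℕ; fromℕ)
import Data.Fin.Properties as Fin
open import Data.Product using (_,_)
open import Data.Sum using (inj₁; inj₂)
open import Data.Sum.Function.Propositional using (_⊎-⇔_)
open import Data.Product.Function.NonDependent.Propositional using (_×-⇔_)
open import Data.Empty using (⊥-elim)
open import Function using (_∘_)
open import Function.Bundles using (mk⇔)
open import Function.Construct.Composition using (_⇔-∘_)
open import Function.Construct.Identity using (⇔-id)
open import Relation.Binary.Definitions using (tri<; tri≈; tri>)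
open import Relation.Binary.PropositionalEquality using (refl; sym; trans; cong; cong₂; subst; module ≡-Reasoning)
open import Relation.Nullary using (¬_; yes; no)
open import Relation.Nullary.Decidable using (⌊_⌋)
open import Algebra.Properties.Semiring.Sum ℤ.+-*-semiring
  using (sum; sum-cong-≗; sum-replicate-zero; ∑-distrib-+; ∑-comm; *-distribʳ-sum)

*-distribˡ-minus : ∀ x y z → x * (y - z) ≡ x * y - x * z
*-distribˡ-minus = solve-∀

*-distribʳ-minus : ∀ x y z → (y - z) * x ≡ y * x - z * x
*-distribʳ-minus = solve-∀

neg-minus : ∀ x y → - (x - y) ≡ y - x
neg-minus = solve-∀

i<j⇒i-j<0 : ∀ {i j} → i ℤ.< j → i - j ℤ.< 0ℤ
i<j⇒i-j<0 {i} {j} i<j = begin-strict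
  i - j  <⟨ ℤ.+-monoˡ-< (- j) i<j ⟩
  j - j  ≡⟨ ℤ.+-inverseʳ j ⟩
  0ℤ     ∎
  where open ℤ.≤-Reasoning

i<j⇒0<j-i : ∀ {i j} → i ℤ.< j → 0ℤ ℤ.< j - i
i<j⇒0<j-i {i} {j} i<j = begin-strict
  0ℤ     ≡⟨ ℤ.+-inverseʳ i ⟨
  i - i  <⟨ ℤ.+-monoˡ-< (- i) i<j ⟩
  j - i  ∎
  where open ℤ.≤-Reasoning

Σℤ≡sum : ∀ {r} (f : Fin r → ℤ) → Σℤ f ≡ sum f
Σℤ≡sum {zero}  f = refl
Σℤ≡sum {suc r} f = cong (_+_ (f zero)) (Σℤ≡sum (f ∘ suc))

sum-zero : ∀ {r} {f : Fin r → ℤ} → (∀ i → f i ≡ 0ℤ) → sum f ≡ 0ℤ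
sum-zero {r} f≗0 = trans (sum-cong-≗ f≗0) (sum-replicate-zero r)

sum-neg : ∀ {r} (f : Fin r → ℤ) → sum (λ i → - f i) ≡ - sum f
sum-neg {zero}  f = refl
sum-neg {suc r} f = trans (cong (_+_ (- f zero)) (sum-neg (f ∘ suc))) (sym (ℤ.neg-distrib-+ (f zero) _))

sum-sub : ∀ {r} (f g : Fin r → ℤ) → sum (λ i → f i - g i) ≡ sum f - sum g
sum-sub f g = trans (∑-distrib-+ f (λ i → - g i)) (cong (_+_ (sum f)) (sum-neg g))

sum-mono-≤ : ∀ {r} {f g : Fin r → ℤ} → (∀ i → f i ℤ.≤ g i) → sum f ℤ.≤ sum g
sum-mono-≤ {zero}  f≤g = ℤ.≤-refl
sum-mono-≤ {suc r} f≤g = ℤ.+-mono-≤ (f≤g zero) (sum-mono-≤ (f≤g ∘ suc))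

sum-mono-< : ∀ {r} {f g : Fin r → ℤ} → (∀ i → f i ℤ.≤ g i) → ∀ k → f k ℤ.< g k → sum f ℤ.< sum g
sum-mono-< f≤g zero    fk<gk = ℤ.+-mono-<-≤ fk<gk (sum-mono-≤ (f≤g ∘ suc))
sum-mono-< f≤g (suc k) fk<gk = ℤ.+-mono-≤-< (f≤g zero) (sum-mono-< (f≤g ∘ suc) k fk<gk)

sum-*-basis : ∀ {r} (x : Fin r → ℤ) (a : Fin r) → sum (λ l → x l * basis a l) ≡ x a
sum-*-basis {suc r} x zero = begin
  x zero * + 1 + sum (λ l → x (suc l) * + 0)
    ≡⟨ cong₂ _+_ (ℤ.*-identityʳ (x zero)) (sum-zero (ℤ.*-zeroʳ ∘ x ∘ suc)) ⟩
  x zero + 0ℤ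
    ≡⟨ ℤ.+-identityʳ (x zero) ⟩
  x zero ∎
  where open ≡-Reasoning
sum-*-basis x (suc a) = begin
  x zero * + 0 + sum (λ l → x (suc l) * basis (suc a) (suc l))
    ≡⟨ cong₂ _+_ (ℤ.*-zeroʳ (x zero)) (sum-cong-≗ (λ l → cong (x (suc l) *_) (basis-suc l))) ⟩
  0ℤ + sum (λ l → x (suc l) * basis a l)
    ≡⟨ ℤ.+-identityˡ _ ⟩
  sum (λ l → x (suc l) * basis a l)
    ≡⟨ sum-*-basis (x ∘ suc) a ⟩
  x (suc a) ∎
  where
  open ≡-Reasoning
  basis-suc : ∀ l → basis (suc a) (suc l) ≡ basis a l
  basis-suc l with a Fin.≟ l
  ... | yes _ = refl
  ... | no _  = refl

⟨⟩-comm : ∀ {r} (x y : Fin r → ℤ) → ⟨ x , y ⟩ ≡ ⟨ y , x ⟩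
⟨⟩-comm x y = begin
  ⟨ x , y ⟩                ≡⟨ Σℤ≡sum (λ i → x i * y i) ⟩
  sum (λ i → x i * y i)    ≡⟨ sum-cong-≗ (λ i → ℤ.*-comm (x i) (y i)) ⟩
  sum (λ i → y i * x i)    ≡⟨ Σℤ≡sum (λ i → y i * x i) ⟨
  ⟨ y , x ⟩                ∎
  where open ≡-Reasoning

⟨⟩-root : ∀ {r} (x : Fin r → ℤ) (a b : Fin r) → ⟨ x , root a b ⟩ ≡ x a - x b
⟨⟩-root x a b = begin
  ⟨ x , root a b ⟩                                            ≡⟨ Σℤ≡sum (λ l → x l * root a b l) ⟩
  sum (λ l → x l * (basis a l - basis b l))                  ≡⟨ sum-cong-≗ (λ l → *-distribˡ-minus (x l) _ _) ⟩
  sum (λ l → x l * basis a l - x l * basis b l)              ≡⟨ sum-sub (λ l → x l * basis a l) (λ l → x l * basis b l) ⟩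
  sum (λ l → x l * basis a l) - sum (λ l → x l * basis b l)  ≡⟨ cong₂ _-_ (sum-*-basis x a) (sum-*-basis x b) ⟩
  x a - x b                                                   ∎
  where open ≡-Reasoning

⟨root⟩ : ∀ {r} (a b : Fin r) (x : Fin r → ℤ) → ⟨ root a b , x ⟩ ≡ x a - x b
⟨root⟩ a b x = trans (⟨⟩-comm (root a b) x) (⟨⟩-root x a b)

sum₂-sub : ∀ {r s} (F F′ : Fin r → Fin s → ℤ) →
  sum (λ a → sum (λ b → F a b - F′ a b)) ≡ sum (λ a → sum (F a)) - sum (λ a → sum (F′ a))
sum₂-sub F F′ = trans (sum-cong-≗ (λ a → sum-sub (F a) (F′ a))) (sum-sub (λ a → sum (F a)) (λ a → sum (F′ a)))

sum-antisymmetrise : ∀ {r} (G : Fin r → Fin r → ℤ) (ν : Fin r → ℤ) →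
  sum (λ a → sum (λ b → G a b * (ν a - ν b))) ≡ sum (λ a → sum (λ b → G a b - G b a) * ν a)
sum-antisymmetrise G ν = begin
  sum (λ a → sum (λ b → G a b * (ν a - ν b)))
    ≡⟨ sum-cong-≗ (λ a → sum-cong-≗ (λ b → *-distribˡ-minus (G a b) (ν a) (ν b))) ⟩
  sum (λ a → sum (λ b → G a b * ν a - G a b * ν b))
    ≡⟨ sum₂-sub (λ a b → G a b * ν a) (λ a b → G a b * ν b) ⟩
  sum (λ a → sum (λ b → G a b * ν a)) - sum (λ a → sum (λ b → G a b * ν b))
    ≡⟨ cong (_-_ (sum (λ a → sum (λ b → G a b * ν a)))) (∑-comm (λ a b → G a b * ν b)) ⟩
  sum (λ a → sum (λ b → G a b * ν a)) - sum (λ a → sum (λ b → G b a * ν a))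
    ≡⟨ sum₂-sub (λ a b → G a b * ν a) (λ a b → G b a * ν a) ⟨
  sum (λ a → sum (λ b → G a b * ν a - G b a * ν a))
    ≡⟨ sum-cong-≗ (λ a → sum-cong-≗ (λ b → *-distribʳ-minus (ν a) (G a b) (G b a))) ⟨
  sum (λ a → sum (λ b → (G a b - G b a) * ν a))
    ≡⟨ sum-cong-≗ (λ a → *-distribʳ-sum (ν a) (λ b → G a b - G b a)) ⟨
  sum (λ a → sum (λ b → G a b - G b a) * ν a) ∎
  where open ≡-Reasoning

module _ {m} (h : Mono m → ℤ) (h-one : h one ≡ 0ℤ) (h-· : ∀ x y → h (x · y) ≡ h x + h y) where

  ∏Fin-homomorphism : ∀ {r} (f : Fin r → Mono m) → h (∏Fin f) ≡ sum (h ∘ f)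
  ∏Fin-homomorphism {zero}  f = h-one
  ∏Fin-homomorphism {suc r} f = trans (h-· (f zero) _) (cong (_+_ (h (f zero))) (∏Fin-homomorphism (f ∘ suc)))

  ∏Φ₊-homomorphism : ∀ {r} (F : Fin r → Fin r → Mono m) →
    h (∏Φ₊ F) ≡ sum (λ a → sum (λ b → if ⌊ a Fin.<? b ⌋ then h (F a b) else 0ℤ))
  ∏Φ₊-homomorphism {r} F =
    trans (∏Fin-homomorphism (∏Fin ∘ row))
          (sum-cong-≗ (λ a → trans (∏Fin-homomorphism (row a)) (sum-cong-≗ (λ b → h-if ⌊ a Fin.<? b ⌋ (F a b)))))
    where
    row : Fin r → Fin r → Mono m
    row a b = if ⌊ a Fin.<? b ⌋ then F a b else one
    h-if : ∀ c x → h (if c then x else one) ≡ (if c then h x else 0ℤ)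
    h-if true  _ = refl
    h-if false _ = h-one

qexp-∏Φ₊ : ∀ {m r} (F : Fin r → Fin r → Mono m) →
  qexp (∏Φ₊ F) ≡ sum (λ a → sum (λ b → if ⌊ a Fin.<? b ⌋ then qexp (F a b) else 0ℤ))
qexp-∏Φ₊ = ∏Φ₊-homomorphism qexp refl (λ _ _ → refl)

kexp-∏Φ₊ : ∀ {m r} (F : Fin r → Fin r → Mono m) →
  kexp (∏Φ₊ F) ≡ sum (λ a → sum (λ b → if ⌊ a Fin.<? b ⌋ then kexp (F a b) else 0ℤ))
kexp-∏Φ₊ = ∏Φ₊-homomorphism kexp refl (λ _ _ → refl)

sgn : ℤ → ℤ
sgn +[1+ _ ] = 1ℤ
sgn (+ 0)    = 0ℤ
sgn -[1+ _ ] = -1ℤ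

sgn-mono-≤ : ∀ {x y} → x ℤ.≤ y → sgn x ℤ.≤ sgn y
sgn-mono-≤ {y = + 0}      -≤+ = -≤+
sgn-mono-≤ {y = +[1+ _ ]} -≤+ = -≤+
sgn-mono-≤ (-≤- _) = ℤ.≤-refl
sgn-mono-≤ (+≤+ {zero}  {zero}  _) = ℤ.≤-refl
sgn-mono-≤ (+≤+ {zero}  {suc _} _) = +≤+ ℕ.z≤n
sgn-mono-≤ (+≤+ {suc _} {suc _} _) = ℤ.≤-refl

sgn-neg-commute : ∀ x → sgn (- x) ≡ - sgn x
sgn-neg-commute +[1+ _ ] = refl
sgn-neg-commute (+ 0)    = refl
sgn-neg-commute -[1+ _ ] = refl

0<x⇒sgn≡1 : ∀ {x} → 0ℤ ℤ.< x → sgn x ≡ 1ℤ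
0<x⇒sgn≡1 {+[1+ _ ]} _ = refl
0<x⇒sgn≡1 {+ 0} (+<+ ())

x<0⇒sgn≡-1 : ∀ {x} → x ℤ.< 0ℤ → sgn x ≡ -1ℤ
x<0⇒sgn≡-1 { -[1+ _ ]} _ = refl
x<0⇒sgn≡-1 {+ 0} (+<+ ())

-- The k-exponent of σ(a) when n ∣ a: σ(a) = k⁻¹ for a > 0, and σ(a) = G₀ = k for a ≤ 0.
kSign : ℤ → ℤ
kSign +[1+ _ ] = -1ℤ
kSign _        = 1ℤ

kSign≢0 : ∀ x → kSign x ≢ 0ℤ
kSign≢0 +[1+ _ ] ()
kSign≢0 (+ 0)    ()
kSign≢0 -[1+ _ ] ()

sgn-tiebreak : ∀ r t x → 0ℤ ℤ.< t → t ℤ.< + r → sgn (t - + r * x) ≡ kSign x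
sgn-tiebreak r t x@(+[1+ m ]) 0<t t<r = x<0⇒sgn≡-1 (i<j⇒i-j<0 (ℤ.<-≤-trans t<r r≤r*x))
  where
  r≤r*x : + r ℤ.≤ + r * x
  r≤r*x = ℤ.≤-trans (ℤ.≤-reflexive (sym (ℤ.*-identityʳ (+ r))))
                    (ℤ.*-monoˡ-≤-nonNeg (+ r) (+≤+ (ℕ.s≤s ℕ.z≤n)))
sgn-tiebreak r t (+ 0) 0<t t<r = 0<x⇒sgn≡1 (begin-strict
  0ℤ             <⟨ 0<t ⟩
  t              ≡⟨ ℤ.+-identityʳ t ⟨
  t - 0ℤ         ≡⟨ cong (_-_ t) (ℤ.*-zeroʳ (+ r)) ⟨
  t - + r * + 0  ∎)
  where open ℤ.≤-Reasoning
sgn-tiebreak r t x@(-[1+ m ]) 0<t t<r = 0<x⇒sgn≡1 (begin-strict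
  0ℤ             <⟨ 0<t ⟩
  t              ≡⟨ ℤ.+-identityʳ t ⟨
  t + 0ℤ         ≤⟨ ℤ.+-monoʳ-≤ t (ℤ.neg-mono-≤ r*x≤0) ⟩
  t - + r * x    ∎)
  where
  open ℤ.≤-Reasoning
  r*x≤0 : + r * x ℤ.≤ 0ℤ
  r*x≤0 = ℤ.≤-trans (ℤ.*-monoˡ-≤-nonNeg (+ r) -≤+) (ℤ.≤-reflexive (ℤ.*-zeroʳ (+ r)))

-- Orders indices by the value of lam, ties broken by the index (as toℕ a < r).
μ : ∀ {r} → (Fin r → ℤ) → Fin r → ℤ
μ {r} lam a = + r * lam a + + toℕ a

sgn-μ : ∀ {r} (lam : Fin r → ℤ) {a b} → a < b → sgn (μ lam b - μ lam a) ≡ kSign (lam a - lam b)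
sgn-μ {r} lam {a} {b} a<b = trans (cong sgn (μ-difference (+ r) (lam a) (lam b) (+ toℕ a) (+ toℕ b)))
                                  (sgn-tiebreak r (+ toℕ b - + toℕ a) (lam a - lam b) 0<b-a b-a<r)
  where
  μ-difference : ∀ r x y s t → (r * y + t) - (r * x + s) ≡ (t - s) - r * (x - y)
  μ-difference = solve-∀
  0<b-a : 0ℤ ℤ.< + toℕ b - + toℕ a
  0<b-a = i<j⇒0<j-i (+<+ a<b)
  b-a<r : + toℕ b - + toℕ a ℤ.< + r
  b-a<r = ℤ.≤-<-trans (ℤ.i≤j⇒i-k≤j (+ toℕ a) ℤ.≤-refl) (+<+ (Fin.toℕ<n b))

μ-injective : ∀ {r} (lam : Fin r → ℤ) {a b} → μ lam a ≡ μ lam b → a ≡ b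
μ-injective lam {a} {b} μa≡μb with Fin.<-cmp a b
... | tri< a<b _ _ = ⊥-elim (kSign≢0 _ (trans (sym (sgn-μ lam a<b)) (cong sgn (ℤ.i≡j⇒i-j≡0 (sym μa≡μb)))))
... | tri≈ _ a≡b _ = a≡b
... | tri> _ _ b<a = ⊥-elim (kSign≢0 _ (trans (sym (sgn-μ lam b<a)) (cong sgn (ℤ.i≡j⇒i-j≡0 μa≡μb))))

∣⇒%ℕ≡0 : ∀ {n} .{{_ : NonZero n}} a → + n ∣ a → a %ℕ n ≡ 0
∣⇒%ℕ≡0 {n} (+ m) n∣a = n∣m⇒m%n≡0 m n (∣⇒∣ᵤ n∣a)
∣⇒%ℕ≡0 {n} -[1+ m ] n∣a with suc m ℕ.% n | n∣m⇒m%n≡0 (suc m) n (∣⇒∣ᵤ n∣a)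
... | zero  | _  = refl
... | suc _ | ()

%ℕ≡0⇒∣ : ∀ {n} .{{_ : NonZero n}} a → a %ℕ n ≡ 0 → + n ∣ a
%ℕ≡0⇒∣ {n} a a%n≡0 = divides (a /ℕ n) (begin
  a                              ≡⟨ a≡a%ℕn+[a/ℕn]*n a n ⟩
  + (a %ℕ n) + (a /ℕ n) * + n    ≡⟨ cong (λ m → + m + (a /ℕ n) * + n) a%n≡0 ⟩
  0ℤ + (a /ℕ n) * + n            ≡⟨ ℤ.+-identityˡ _ ⟩
  (a /ℕ n) * + n                 ∎)
  where open ≡-Reasoning

∣-minus-sym : ∀ {k} x y → k ∣ x - y → k ∣ y - x
∣-minus-sym {k} x y k∣x-y = subst (k ∣_) (neg-minus x y) (∣m⇒∣-m k∣x-y)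

∣-minus-trans : ∀ {k} x y z → k ∣ x - y → k ∣ y - z → k ∣ x - z
∣-minus-trans {k} x y z k∣x-y k∣y-z = subst (k ∣_) (ℤ.+-minus-telescope x y z) (∣m∣n⇒∣m+n k∣x-y k∣y-z)

-[s*n]-d≡0⇔ : ∀ n .{{_ : NonZero n}} s d → 0ℤ ℤ.≤ d → d ℤ.≤ + n →
  (- (s * + n) - d ≡ + 0) ⇔ ((s ≡ + 0 × d ≡ + 0) ⊎ (s ≡ - (+ 1) × d ≡ + n))
-[s*n]-d≡0⇔ n@(suc n′) s d 0≤d d≤n =
  mk⇔ (λ eq → to s d 0≤d d≤n (sym (ℤ.i-j≡0⇒i≡j _ d eq))) (λ where
    (inj₁ (refl , refl)) → refl
    (inj₂ (refl , refl)) → ℤ.i≡j⇒i-j≡0 -[-1*n]≡n)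
  where
  -[-1*n]≡n : - (-1ℤ * + n) ≡ + n
  -[-1*n]≡n = trans (cong -_ (ℤ.-1*i≡-i (+ n))) (ℤ.neg-involutive (+ n))
  -- For s > 0, −sn is negative and for s < −1 it exceeds n; with n = suc n′ both show up as constructors.
  to : ∀ s d → 0ℤ ℤ.≤ d → d ℤ.≤ + n → d ≡ - (s * + n) → (s ≡ + 0 × d ≡ + 0) ⊎ (s ≡ - (+ 1) × d ≡ + n)
  to (+ 0)           _ _  _   d≡ = inj₁ (refl , d≡)
  to +[1+ _ ]        _ () _   refl
  to -[1+ 0 ]        _ _  _   d≡ = inj₂ (refl , trans d≡ -[-1*n]≡n)
  to -[1+ suc _ ]    _ _  d≤n refl = ⊥-elim (ℕ.m+1+n≰m n′ (ℕ.s≤s⁻¹ (ℤ.drop‿+≤+ d≤n)))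

InA⇒0≤lamᵢ-lamⱼ≤n : ∀ {n r} {lam : Fin (suc r) → ℤ} → InA n (suc r) lam →
  ∀ {i j} → i Fin.≤ j → 0ℤ ℤ.≤ lam i - lam j × lam i - lam j ℤ.≤ + n
InA⇒0≤lamᵢ-lamⱼ≤n {r = r} {lam} (antitone , spread≤n) {i} {j} i≤j =
  ℤ.i≤j⇒0≤j-i (antitone i j i≤j) , ℤ.≤-trans lamᵢ-lamⱼ≤spread spread≤n
  where
  lamᵢ-lamⱼ≤spread : lam i - lam j ℤ.≤ lam zero - lam (fromℕ r)
  lamᵢ-lamⱼ≤spread = ℤ.+-mono-≤ (antitone zero i ℕ.z≤n) (ℤ.neg-mono-≤ (antitone j (fromℕ r) (Fin.≤fromℕ j)))

module _ (n : ℕ) .{{_ : NonZero n}} (eps : Bool) where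

  qexp-σ : ∀ a → qexp (σ n eps a) ≡ 0ℤ
  qexp-σ a with (0 ℕ.<ᵇ ∣ a ∣) ∧ ⌊ 0ℤ ℤ.<? a ⌋ ∧ (a %ℕ n ℕ.≡ᵇ 0)
  ... | true  = refl
  ... | false with a %ℕ n
  ...   | t with t ℕ.≡ᵇ 0 | t ℕ.≤ᵇ mOf n | 2 ℕ.* t ℕ.≡ᵇ n
  ...     | true  | _     | _     = refl
  ...     | false | true  | _     = refl
  ...     | false | false | true  = refl
  ...     | false | false | false = refl

  kexp-σ-∣ : ∀ a → + n ∣ a → kexp (σ n eps a) ≡ kSign a
  kexp-σ-∣ a n∣a rewrite ∣⇒%ℕ≡0 a n∣a with a
  ... | + 0      = refl
  ... | +[1+ _ ] = refl
  ... | -[1+ _ ] = refl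

  kexp-σ-∤ : ∀ a → ¬ (+ n ∣ a) → kexp (σ n eps a) ≡ 0ℤ
  kexp-σ-∤ a n∤a with a %ℕ n in a%n
  ... | zero  = ⊥-elim (n∤a (%ℕ≡0⇒∣ a a%n))
  ... | suc t rewrite ∧-zeroʳ ⌊ 0ℤ ℤ.<? a ⌋ | ∧-zeroʳ (0 ℕ.<ᵇ ∣ a ∣)
    with suc t ℕ.≤ᵇ mOf n | 2 ℕ.* suc t ℕ.≡ᵇ n
  ...   | true  | _     = refl
  ...   | false | true  = refl
  ...   | false | false = refl

  qexp-γ : ∀ {r} (ν : Fin r → ℤ) s lam → qexp (γ n eps ν s lam) ≡ - (s * + n) - ⟨ ν , lam ⟩
  qexp-γ {r} ν s lam = begin
    1ℤ * e + qexp (∏Φ₊ F)  ≡⟨ cong (_+ qexp (∏Φ₊ F)) (ℤ.*-identityˡ e) ⟩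
    e + qexp (∏Φ₊ F)       ≡⟨ cong (_+_ e) (trans (qexp-∏Φ₊ F) (sum-zero (λ a → sum-zero (qexp-F a)))) ⟩
    e + 0ℤ                 ≡⟨ ℤ.+-identityʳ e ⟩
    e                      ∎
    where
    open ≡-Reasoning
    e : ℤ
    e = - (s * + n) - ⟨ ν , lam ⟩
    F : Fin r → Fin r → Mono (mOf n)
    F a b = σ n eps ⟨ lam , root a b ⟩ ^ᶻ ⟨ ν , root a b ⟩
    qexp-F : ∀ a b → (if ⌊ a Fin.<? b ⌋ then qexp (F a b) else 0ℤ) ≡ 0ℤ
    qexp-F a b with ⌊ a Fin.<? b ⌋
    ... | true  = cong (_* ⟨ ν , root a b ⟩) (qexp-σ ⟨ lam , root a b ⟩)
    ... | false = refl

  module _ {r} (lam : Fin r → ℤ) where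

    κ₊ : Fin r → Fin r → ℤ
    κ₊ a b = if ⌊ a Fin.<? b ⌋ then kexp (σ n eps (lam a - lam b)) else 0ℤ

    κ : Fin r → Fin r → ℤ
    κ a b = κ₊ a b - κ₊ b a

    κ-row : Fin r → ℤ
    κ-row a = sum (κ a)

    kexp-γ : ∀ ν s → kexp (γ n eps ν s lam) ≡ sum (λ a → κ-row a * ν a)
    kexp-γ ν s = begin
      0ℤ + kexp (∏Φ₊ F)                                    ≡⟨ ℤ.+-identityˡ _ ⟩
      kexp (∏Φ₊ F)                                         ≡⟨ kexp-∏Φ₊ F ⟩
      sum (λ a → sum (λ b → if ⌊ a Fin.<? b ⌋ then kexp (F a b) else 0ℤ))
                                                           ≡⟨ sum-cong-≗ (λ a → sum-cong-≗ (kexp-F a)) ⟩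
      sum (λ a → sum (λ b → κ₊ a b * (ν a - ν b)))         ≡⟨ sum-antisymmetrise κ₊ ν ⟩
      sum (λ a → κ-row a * ν a)                            ∎
      where
      open ≡-Reasoning
      F : Fin r → Fin r → Mono (mOf n)
      F a b = σ n eps ⟨ lam , root a b ⟩ ^ᶻ ⟨ ν , root a b ⟩
      kexp-F : ∀ a b → (if ⌊ a Fin.<? b ⌋ then kexp (F a b) else 0ℤ) ≡ κ₊ a b * (ν a - ν b)
      kexp-F a b with ⌊ a Fin.<? b ⌋
      ... | true  = cong₂ _*_ (cong (kexp ∘ σ n eps) (⟨⟩-root lam a b)) (⟨⟩-root ν a b)
      ... | false = refl

    κ₊-< : ∀ {a b} → a < b → κ₊ a b ≡ kexp (σ n eps (lam a - lam b))
    κ₊-< {a} {b} a<b with a Fin.<? b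
    ... | yes _   = refl
    ... | no a≮b = ⊥-elim (a≮b a<b)

    κ₊-≮ : ∀ {a b} → ¬ a < b → κ₊ a b ≡ 0ℤ
    κ₊-≮ {a} {b} a≮b with a Fin.<? b
    ... | yes a<b = ⊥-elim (a≮b a<b)
    ... | no _    = refl

    κ₊-∤ : ∀ {a b} → ¬ (+ n ∣ lam a - lam b) → κ₊ a b ≡ 0ℤ
    κ₊-∤ {a} {b} n∤ with ⌊ a Fin.<? b ⌋
    ... | true  = kexp-σ-∤ (lam a - lam b) n∤
    ... | false = refl

    κ-diagonal : ∀ a → κ a a ≡ 0ℤ
    κ-diagonal a = ℤ.+-inverseʳ (κ₊ a a)

    κ-<-∣ : ∀ a b → a < b → + n ∣ lam a - lam b → κ a b ≡ sgn (μ lam b - μ lam a)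
    κ-<-∣ a b a<b n∣ = begin
      κ₊ a b - κ₊ b a                       ≡⟨ cong₂ _-_ (κ₊-< a<b) (κ₊-≮ (Fin.<-asym a<b)) ⟩
      kexp (σ n eps (lam a - lam b)) - 0ℤ   ≡⟨ ℤ.+-identityʳ _ ⟩
      kexp (σ n eps (lam a - lam b))        ≡⟨ kexp-σ-∣ (lam a - lam b) n∣ ⟩
      kSign (lam a - lam b)                 ≡⟨ sgn-μ lam a<b ⟨
      sgn (μ lam b - μ lam a)               ∎
      where open ≡-Reasoning

    κ-∣ : ∀ a b → + n ∣ lam a - lam b → κ a b ≡ sgn (μ lam b - μ lam a)
    κ-∣ a b n∣ with Fin.<-cmp a b
    ... | tri< a<b _ _ = κ-<-∣ a b a<b n∣
    ... | tri≈ _ refl _ = trans (κ-diagonal a) (cong sgn (sym (ℤ.+-inverseʳ (μ lam a))))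
    ... | tri> _ _ b<a = begin
      κ₊ a b - κ₊ b a             ≡⟨ neg-minus (κ₊ b a) (κ₊ a b) ⟨
      - κ b a                     ≡⟨ cong -_ (κ-<-∣ b a b<a (∣-minus-sym (lam a) (lam b) n∣)) ⟩
      - sgn (μ lam a - μ lam b)   ≡⟨ sgn-neg-commute (μ lam a - μ lam b) ⟨
      sgn (- (μ lam a - μ lam b)) ≡⟨ cong sgn (neg-minus (μ lam a) (μ lam b)) ⟩
      sgn (μ lam b - μ lam a)     ∎
      where open ≡-Reasoning

    κ-∤ : ∀ a b → ¬ (+ n ∣ lam a - lam b) → κ a b ≡ 0ℤ
    κ-∤ a b n∤ = cong₂ _-_ (κ₊-∤ n∤) (κ₊-∤ (n∤ ∘ ∣-minus-sym (lam b) (lam a)))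

    κ-column-mono : ∀ {i j} → + n ∣ lam i - lam j → μ lam i ℤ.< μ lam j → ∀ b → κ j b ℤ.≤ κ i b
    κ-column-mono {i} {j} n∣ij μi<μj b with + n ∣? lam i - lam b
    ... | yes n∣ib = begin
      κ j b                   ≡⟨ κ-∣ j b n∣jb ⟩
      sgn (μ lam b - μ lam j) ≤⟨ sgn-mono-≤ μb-μj≤μb-μi ⟩
      sgn (μ lam b - μ lam i) ≡⟨ κ-∣ i b n∣ib ⟨
      κ i b                   ∎
      where
      open ℤ.≤-Reasoning
      n∣jb : + n ∣ lam j - lam b
      n∣jb = ∣-minus-trans (lam j) (lam i) (lam b) (∣-minus-sym (lam i) (lam j) n∣ij) n∣ib
      μb-μj≤μb-μi : μ lam b - μ lam j ℤ.≤ μ lam b - μ lam i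
      μb-μj≤μb-μi = ℤ.+-monoʳ-≤ (μ lam b) (ℤ.neg-mono-≤ (ℤ.<⇒≤ μi<μj))
    ... | no n∤ib = ℤ.≤-reflexive (trans (κ-∤ j b n∤jb) (sym (κ-∤ i b n∤ib)))
      where
      n∤jb : ¬ (+ n ∣ lam j - lam b)
      n∤jb = n∤ib ∘ ∣-minus-trans (lam i) (lam j) (lam b) n∣ij

    κ-row-< : ∀ {i j} → + n ∣ lam i - lam j → μ lam i ℤ.< μ lam j → κ-row j ℤ.< κ-row i
    κ-row-< {i} {j} n∣ij μi<μj = sum-mono-< (κ-column-mono n∣ij μi<μj) i (begin-strict
      κ j i                    ≡⟨ κ-∣ j i (∣-minus-sym (lam i) (lam j) n∣ij) ⟩
      sgn (μ lam i - μ lam j)  ≡⟨ x<0⇒sgn≡-1 (i<j⇒i-j<0 μi<μj) ⟩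
      -1ℤ                      <⟨ -<+ ⟩
      0ℤ                       ≡⟨ κ-diagonal i ⟨
      κ i i                    ∎)
      where open ℤ.≤-Reasoning

    qPower-root : ∀ i j s → qPower n eps (root i j) s lam ≡ - (s * + n) - (lam i - lam j)
    qPower-root i j s = trans (qexp-γ (root i j) s lam) (cong (_-_ (- (s * + n))) (⟨root⟩ i j lam))

    kexp-γ-root : ∀ i j s → kexp (γ n eps (root i j) s lam) ≡ κ-row i - κ-row j
    kexp-γ-root i j s =
      trans (kexp-γ (root i j) s) (trans (sym (Σℤ≡sum (λ a → κ-row a * root i j a))) (⟨⟩-root κ-row i j))

    κ-row-injective : ∀ {i j} → + n ∣ lam i - lam j → κ-row i ≡ κ-row j → i ≡ j
    κ-row-injective {i} {j} n∣ij κi≡κj with ℤ.<-cmp (μ lam i) (μ lam j)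
    ... | tri< μi<μj _ _ = ⊥-elim (ℤ.<-irrefl (sym κi≡κj) (κ-row-< n∣ij μi<μj))
    ... | tri≈ _ μi≡μj _ = μ-injective lam μi≡μj
    ... | tri> _ _ μj<μi = ⊥-elim (ℤ.<-irrefl κi≡κj (κ-row-< (∣-minus-sym (lam i) (lam j) n∣ij) μj<μi))

    γ≢one : ∀ {i j} → i ≢ j → ∀ s → γ n eps (root i j) s lam ≢ one
    γ≢one {i} {j} i≢j s γ≡one = i≢j (κ-row-injective n∣λi-λj κ-rowi≡κ-rowj)
      where
      n∣λi-λj : + n ∣ lam i - lam j
      n∣λi-λj = divides (- s) (begin
        lam i - lam j  ≡⟨ ℤ.i-j≡0⇒i≡j _ _ (trans (sym (qPower-root i j s)) (cong qexp γ≡one)) ⟨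
        - (s * + n)    ≡⟨ ℤ.neg-distribˡ-* s (+ n) ⟩
        - s * + n      ∎)
        where open ≡-Reasoning
      κ-rowi≡κ-rowj : κ-row i ≡ κ-row j
      κ-rowi≡κ-rowj = ℤ.i-j≡0⇒i≡j _ _ (trans (sym (kexp-γ-root i j s)) (cong kexp γ≡one))

  qPower≡0⇔ : ∀ {r} (lam : Fin (suc r) → ℤ) → InA n (suc r) lam → ∀ {i j} → i < j → ∀ s →
    (qPower n eps (root i j) s lam ≡ + 0)
      ⇔ ((s ≡ + 0 × lam i ≡ lam j) ⊎ (s ≡ - (+ 1) × lam i - lam j ≡ + n))
  qPower≡0⇔ lam lam∈A {i} {j} i<j s rewrite qPower-root lam i j s =
    let 0≤d , d≤n = InA⇒0≤lamᵢ-lamⱼ≤n lam∈A (ℕ.<⇒≤ i<j) in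
    ((⇔-id _ ×-⇔ mk⇔ (ℤ.i-j≡0⇒i≡j (lam i) (lam j)) ℤ.i≡j⇒i-j≡0) ⊎-⇔ ⇔-id _)
      ⇔-∘ -[s*n]-d≡0⇔ n s (lam i - lam j) 0≤d d≤n

lemma2p20 : (r n : ℕ) → 2 ≤ r → .{{_ : NonZero n}} → (eps : Bool) →
    ((lam : Fin r → ℤ) → InA n r lam → (i j : Fin r) → i < j → (s : ℤ) →
      (qPower n eps (root i j) s lam ≡ + 0)
        ⇔ ((s ≡ + 0 × lam i ≡ lam j) ⊎ (s ≡ - (+ 1) × lam i - lam j ≡ + n)))
    × ((i j : Fin r) → i ≢ j → (s : ℤ) → (lam : Fin r → ℤ) →
      γ n eps (root i j) s lam ≢ one)
lemma2p20 (suc r) n _ eps =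
  (λ lam lam∈A i j i<j → qPower≡0⇔ n eps lam lam∈A i<j) ,
  (λ i j i≢j s lam → γ≢one n eps lam i≢j s)
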